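{- Let $(A,R)$ be an associative Rota–Baxter algebra of weight $1$ over a field of characteristic zero, and define $a\bullet_R b:=R(a)b-bR(a)-ba$. Then $(A,\bullet_R)$, with the operator $R$, is a Rota–Baxter pre-Lie algebra of weight $1$: $(A,\bullet_R)$ is left pre-Lie and for all $a,b\in A$, $$R(a)\bullet_R R(b)=R\big(R(a)\bullet_R b+a\bullet_R R(b)\big)+R(a\bullet_R b).$$
   Context: A Rota–Baxter algebra of weight $1$ is an algebra $A$ with a linear map $R$ satisfying $R(a)R(b)=R(R(a)b+aR(b))+R(ab)$ for all $a,b\in A$. A left pre-Lie algebra is a vector space with a bilinear product $\bullet$ satisfying $(a\bullet b)\bullet c-a\bullet(b\bullet c)=(b\bullet a)\bullet c-b\bullet(a\bullet c)$. -}

module Defs where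

open import Level using (Level; _⊔_) renaming (suc to lsuc)
open import Data.Nat using (ℕ; zero; suc)
open import Data.Product using (Σ; _×_)
open import Relation.Nullary using (¬_)
open import Algebra.Bundles using (CommutativeRing)
open import Algebra.Module.Bundles using (Module)

record IsField {c ℓ : Level} (K : CommutativeRing c ℓ) : Set (c ⊔ ℓ) where
  open CommutativeRing K
  field
    0≉1     : ¬ (0# ≈ 1#)
    inverse : ∀ x → ¬ (x ≈ 0#) → Σ Carrier λ y → (x * y) ≈ 1#

module _ {c ℓ : Level} (K : CommutativeRing c ℓ) where
  open CommutativeRing K
  natCast : ℕ → Carrier
  natCast zero    = 0#
  natCast (suc n) = 1# + natCast n

CharZero : {c ℓ : Level} (K : CommutativeRing c ℓ) → Set ℓ
CharZero K = ∀ n → ¬ (CommutativeRing._≈_ K (natCast K (suc n)) (CommutativeRing.0# K))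

record AssocAlgebra {c ℓ : Level} (K : CommutativeRing c ℓ) (m ℓm : Level)
       : Set (c ⊔ ℓ ⊔ lsuc (m ⊔ ℓm)) where
  open CommutativeRing K using () renaming (Carrier to S)
  field
    module' : Module K m ℓm
  open Module module' public
  infixl 7 _·_
  field
    _·_      : Carrierᴹ → Carrierᴹ → Carrierᴹ
    ·-cong   : ∀ {a a′ b b′} → a ≈ᴹ a′ → b ≈ᴹ b′ → (a · b) ≈ᴹ (a′ · b′)
    ·-assoc  : ∀ a b c → ((a · b) · c) ≈ᴹ (a · (b · c))
    ·-distribˡ : ∀ a b c → (a · (b +ᴹ c)) ≈ᴹ ((a · b) +ᴹ (a · c))
    ·-distribʳ : ∀ a b c → ((b +ᴹ c) · a) ≈ᴹ ((b · a) +ᴹ (c · a))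
    ·-scalarˡ : ∀ (k : S) a b → ((k *ₗ a) · b) ≈ᴹ (k *ₗ (a · b))
    ·-scalarʳ : ∀ (k : S) a b → (a · (k *ₗ b)) ≈ᴹ (k *ₗ (a · b))

module _ {c ℓ m ℓm : Level} {K : CommutativeRing c ℓ} (A : AssocAlgebra K m ℓm) where
  open CommutativeRing K using () renaming (Carrier to S)
  open AssocAlgebra A

  record IsLinear (R : Carrierᴹ → Carrierᴹ) : Set (c ⊔ m ⊔ ℓm) where
    field
      cong  : ∀ {a b} → a ≈ᴹ b → R a ≈ᴹ R b
      additive : ∀ a b → R (a +ᴹ b) ≈ᴹ (R a +ᴹ R b)
      homogeneous : ∀ (k : S) a → R (k *ₗ a) ≈ᴹ (k *ₗ R a)

  RBIdentity₁ : (Carrierᴹ → Carrierᴹ → Carrierᴹ) → (Carrierᴹ → Carrierᴹ) → Set (m ⊔ ℓm)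
  RBIdentity₁ _∘_ R = ∀ a b →
    (R a ∘ R b) ≈ᴹ (R ((R a ∘ b) +ᴹ (a ∘ R b)) +ᴹ R (a ∘ b))

  IsRotaBaxter₁ : (Carrierᴹ → Carrierᴹ) → Set (c ⊔ m ⊔ ℓm)
  IsRotaBaxter₁ R = IsLinear R × RBIdentity₁ _·_ R

  bulletR : (Carrierᴹ → Carrierᴹ) → Carrierᴹ → Carrierᴹ → Carrierᴹ
  bulletR R a b = ((R a · b) +ᴹ (-ᴹ (b · R a))) +ᴹ (-ᴹ (b · a))

  IsLeftPreLie : (Carrierᴹ → Carrierᴹ → Carrierᴹ) → Set (m ⊔ ℓm)
  IsLeftPreLie _∘_ = ∀ a b c →
    (((a ∘ b) ∘ c) +ᴹ (-ᴹ (a ∘ (b ∘ c))))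
      ≈ᴹ (((b ∘ a) ∘ c) +ᴹ (-ᴹ (b ∘ (a ∘ c))))

  IsRotaBaxterPreLie₁ : (Carrierᴹ → Carrierᴹ → Carrierᴹ) → (Carrierᴹ → Carrierᴹ) → Set (m ⊔ ℓm)
  IsRotaBaxterPreLie₁ _∘_ R = IsLeftPreLie _∘_ × RBIdentity₁ _∘_ R

{-# OPTIONS --safe #-}
module Submission where

-- The weight-1 Rota–Baxter identity says precisely that R is multiplicative
-- from a ⋆ b = R a b + a R b + a b to the product of A.  As a ring identity,
-- a • b − b • a = a ⋆ b − b ⋆ a, so R(a • b) − R(b • a) = [R a, R b]; and in any
-- ring the antisymmetrised associator of • at (a, b, c) equals
-- [R(a • b) − R(b • a) − [R a, R b], c], which therefore vanishes.  Likewise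
-- R a • R b = R(R a ⋆ b − b ⋆ R a − b ⋆ a), and that argument is the ring
-- expression R a • b + a • R b + a • b.

open import Defs
open import Level using (Level; 0ℓ; _⊔_)
open import Algebra.Bundles using (CommutativeRing; RingWithoutOne; CommutativeSemigroup)
open import Data.Fin.Base using (Fin)
open import Data.Fin.Properties using (<-strictTotalOrder)
open import Data.List.Base as List using (List; []; _∷_; map; foldr)
open import Data.List.NonEmpty.Base using (List⁺; _∷_; [_]; toList; _⁺++⁺_)
import Data.List.Relation.Binary.Lex.Strict as Lex
open import Data.List.Relation.Binary.Pointwise using (Pointwise-≡⇒≡)
open import Data.Nat.Base using (ℕ)
open import Data.Product.Base using (_×_; _,_)
import Data.Sign.Base as Sign
open Sign using (Sign)
import Data.Sign.Properties as Signₚ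
open import Data.Vec.Base using (Vec; lookup)
open import Relation.Binary.Bundles using (StrictTotalOrder)
open import Relation.Binary.Definitions using (tri<; tri≈; tri>)
import Relation.Binary.PropositionalEquality.Core as ≡
open ≡ using (_≢_)
open import Relation.Nullary.Decidable.Core using (yes; no)
open import Relation.Nullary.Negation.Core using (contradiction)
import Relation.Binary.Reflection as Reflection

module NonUnitalRingSolver {r ℓ} (𝓡 : RingWithoutOne r ℓ) where

  open RingWithoutOne 𝓡
  open import Algebra.Properties.RingWithoutOne 𝓡
  open import Relation.Binary.Reasoning.Setoid setoid

  private
    +-commutativeSemigroup : CommutativeSemigroup r ℓ
    +-commutativeSemigroup = record { isCommutativeSemigroup = +-isCommutativeSemigroup }

  open import Algebra.Properties.CommutativeSemigroup +-commutativeSemigroup using (x∙yz≈y∙xz)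

  infixl 6 _⊕_ _⊖_
  infixl 7 _⊗_
  infix  8 ⊝_

  data Expr (n : ℕ) : Set where
    var      : Fin n → Expr n
    _⊕_ _⊗_ : Expr n → Expr n → Expr n
    ⊝_       : Expr n → Expr n

  _⊖_ : ∀ {n} → Expr n → Expr n → Expr n
  e ⊖ f = e ⊕ ⊝ f

  ⟦_⟧ : ∀ {n} → Expr n → Vec Carrier n → Carrier
  ⟦ var i ⟧ ρ = lookup ρ i
  ⟦ e ⊕ f ⟧ ρ = ⟦ e ⟧ ρ + ⟦ f ⟧ ρ
  ⟦ e ⊗ f ⟧ ρ = ⟦ e ⟧ ρ * ⟦ f ⟧ ρ
  ⟦ ⊝ e ⟧   ρ = - ⟦ e ⟧ ρ

  -- Normal forms are lists of signed nonempty words, sorted by word, in which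
  -- no word occurs with both signs.  Soundness does not depend on this
  -- invariant; it makes normal forms canonical, so that `solve` can close a
  -- goal by reflexivity.
  Monomial : ℕ → Set
  Monomial n = Sign × List⁺ (Fin n)

  Normal : ℕ → Set
  Normal n = List (Monomial n)

  negate : ∀ {n} → Monomial n → Monomial n
  negate (s , w) = (Sign.opposite s , w)

  _·ᵐ_ : ∀ {n} → Monomial n → Monomial n → Monomial n
  (s , v) ·ᵐ (t , w) = (s Sign.* t , v ⁺++⁺ w)

  wordOrder : ℕ → StrictTotalOrder 0ℓ 0ℓ 0ℓ
  wordOrder n = Lex.<-strictTotalOrder (<-strictTotalOrder n)

  insert : ∀ {n} → Monomial n → Normal n → Normal n
  insert m [] = m ∷ []
  insert {n} (s , v) ((t , w) ∷ p)
    with StrictTotalOrder.compare (wordOrder n) (toList v) (toList w)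
  ... | tri< _ _ _ = (s , v) ∷ (t , w) ∷ p
  ... | tri> _ _ _ = (t , w) ∷ insert (s , v) p
  ... | tri≈ _ _ _ with s Signₚ.≟ t
  ...   | yes _ = (s , v) ∷ (t , w) ∷ p
  ...   | no  _ = p

  infixl 6 _⊞_
  infixl 7 _⊠_

  _⊞_ : ∀ {n} → Normal n → Normal n → Normal n
  p ⊞ q = foldr insert q p

  _⊠_ : ∀ {n} → Normal n → Normal n → Normal n
  p ⊠ q = foldr (λ m → map (m ·ᵐ_) q ⊞_) [] p

  normalise : ∀ {n} → Expr n → Normal n
  normalise (var i) = (Sign.+ , [ i ]) ∷ []
  normalise (e ⊕ f) = normalise e ⊞ normalise f
  normalise (e ⊗ f) = normalise e ⊠ normalise f
  normalise (⊝ e)   = map negate (normalise e)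

  module _ {n} (ρ : Vec Carrier n) where

    product : Fin n → List (Fin n) → Carrier
    product i []       = lookup ρ i
    product i (j ∷ js) = lookup ρ i * product j js

    ⟦_⟧ʷ : List⁺ (Fin n) → Carrier
    ⟦ i ∷ is ⟧ʷ = product i is

    ⟦_⟧ᵐ : Monomial n → Carrier
    ⟦ Sign.+ , w ⟧ᵐ = ⟦ w ⟧ʷ
    ⟦ Sign.- , w ⟧ᵐ = - ⟦ w ⟧ʷ

    ⟦_⟧ⁿ : Normal n → Carrier
    ⟦ [] ⟧ⁿ    = 0#
    ⟦ m ∷ p ⟧ⁿ = ⟦ m ⟧ᵐ + ⟦ p ⟧ⁿ

    product-++ : ∀ i is j js → product i (is List.++ j ∷ js) ≈ product i is * product j js
    product-++ i []       j js = refl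
    product-++ i (k ∷ ks) j js = begin
      lookup ρ i * product k (ks List.++ j ∷ js)    ≈⟨ *-congˡ (product-++ k ks j js) ⟩
      lookup ρ i * (product k ks * product j js)  ≈⟨ *-assoc _ _ _ ⟨
      lookup ρ i * product k ks * product j js    ∎

    ⟦⁺++⁺⟧ʷ : ∀ v w → ⟦ v ⁺++⁺ w ⟧ʷ ≈ ⟦ v ⟧ʷ * ⟦ w ⟧ʷ
    ⟦⁺++⁺⟧ʷ (i ∷ is) (j ∷ js) = product-++ i is j js

    ⟦·ᵐ⟧ : ∀ m m′ → ⟦ m ·ᵐ m′ ⟧ᵐ ≈ ⟦ m ⟧ᵐ * ⟦ m′ ⟧ᵐ
    ⟦·ᵐ⟧ (Sign.+ , v) (Sign.+ , w) = ⟦⁺++⁺⟧ʷ v w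
    ⟦·ᵐ⟧ (Sign.+ , v) (Sign.- , w) = trans (-‿cong (⟦⁺++⁺⟧ʷ v w)) (-‿distribʳ-* _ _)
    ⟦·ᵐ⟧ (Sign.- , v) (Sign.+ , w) = trans (-‿cong (⟦⁺++⁺⟧ʷ v w)) (-‿distribˡ-* _ _)
    ⟦·ᵐ⟧ (Sign.- , v) (Sign.- , w) = begin
      ⟦ v ⁺++⁺ w ⟧ʷ           ≈⟨ ⟦⁺++⁺⟧ʷ v w ⟩
      ⟦ v ⟧ʷ * ⟦ w ⟧ʷ         ≈⟨ -‿involutive _ ⟨
      - - (⟦ v ⟧ʷ * ⟦ w ⟧ʷ)   ≈⟨ -‿cong (-‿distribˡ-* _ _) ⟩
      - (- ⟦ v ⟧ʷ * ⟦ w ⟧ʷ)   ≈⟨ -‿distribʳ-* _ _ ⟩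
      - ⟦ v ⟧ʷ * - ⟦ w ⟧ʷ     ∎

    ⟦negate⟧ : ∀ m → ⟦ negate m ⟧ᵐ ≈ - ⟦ m ⟧ᵐ
    ⟦negate⟧ (Sign.+ , w) = refl
    ⟦negate⟧ (Sign.- , w) = sym (-‿involutive _)

    ⟦insert⟧ : ∀ m p → ⟦ insert m p ⟧ⁿ ≈ ⟦ m ⟧ᵐ + ⟦ p ⟧ⁿ
    ⟦insert⟧ m [] = refl
    ⟦insert⟧ (s , v) ((t , w) ∷ p)
      with StrictTotalOrder.compare (wordOrder n) (toList v) (toList w)
    ... | tri< _ _ _ = refl
    ... | tri> _ _ _ = begin
      ⟦ t , w ⟧ᵐ + ⟦ insert (s , v) p ⟧ⁿ     ≈⟨ +-congˡ (⟦insert⟧ (s , v) p) ⟩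
      ⟦ t , w ⟧ᵐ + (⟦ s , v ⟧ᵐ + ⟦ p ⟧ⁿ)     ≈⟨ x∙yz≈y∙xz _ _ _ ⟩
      ⟦ s , v ⟧ᵐ + (⟦ t , w ⟧ᵐ + ⟦ p ⟧ⁿ)     ∎
    ... | tri≈ _ v≡w _ with s Signₚ.≟ t | Pointwise-≡⇒≡ v≡w
    ...   | yes _ | _ = refl
    ...   | no s≢t | ≡.refl = sym (cancel s t s≢t)
      where
      cancel : ∀ s t → s ≢ t → ⟦ s , v ⟧ᵐ + (⟦ t , v ⟧ᵐ + ⟦ p ⟧ⁿ) ≈ ⟦ p ⟧ⁿ
      cancel Sign.+ Sign.- _ = \\-leftDividesˡ _ _
      cancel Sign.- Sign.+ _ = \\-leftDividesʳ _ _
      cancel Sign.+ Sign.+ s≢t = contradiction ≡.refl s≢t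
      cancel Sign.- Sign.- s≢t = contradiction ≡.refl s≢t

    ⟦⊞⟧ : ∀ p q → ⟦ p ⊞ q ⟧ⁿ ≈ ⟦ p ⟧ⁿ + ⟦ q ⟧ⁿ
    ⟦⊞⟧ []      q = sym (+-identityˡ _)
    ⟦⊞⟧ (m ∷ p) q = begin
      ⟦ insert m (p ⊞ q) ⟧ⁿ      ≈⟨ ⟦insert⟧ m (p ⊞ q) ⟩
      ⟦ m ⟧ᵐ + ⟦ p ⊞ q ⟧ⁿ        ≈⟨ +-congˡ (⟦⊞⟧ p q) ⟩
      ⟦ m ⟧ᵐ + (⟦ p ⟧ⁿ + ⟦ q ⟧ⁿ) ≈⟨ +-assoc _ _ _ ⟨
      ⟦ m ⟧ᵐ + ⟦ p ⟧ⁿ + ⟦ q ⟧ⁿ   ∎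

    ⟦map-negate⟧ : ∀ p → ⟦ map negate p ⟧ⁿ ≈ - ⟦ p ⟧ⁿ
    ⟦map-negate⟧ []      = sym -0#≈0#
    ⟦map-negate⟧ (m ∷ p) = begin
      ⟦ negate m ⟧ᵐ + ⟦ map negate p ⟧ⁿ ≈⟨ +-cong (⟦negate⟧ m) (⟦map-negate⟧ p) ⟩
      - ⟦ m ⟧ᵐ + - ⟦ p ⟧ⁿ                ≈⟨ -‿+-comm _ _ ⟩
      - (⟦ m ⟧ᵐ + ⟦ p ⟧ⁿ)                ∎

    ⟦map-·ᵐ⟧ : ∀ m q → ⟦ map (m ·ᵐ_) q ⟧ⁿ ≈ ⟦ m ⟧ᵐ * ⟦ q ⟧ⁿ
    ⟦map-·ᵐ⟧ m []       = sym (zeroʳ _)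
    ⟦map-·ᵐ⟧ m (m′ ∷ q) = begin
      ⟦ m ·ᵐ m′ ⟧ᵐ + ⟦ map (m ·ᵐ_) q ⟧ⁿ  ≈⟨ +-cong (⟦·ᵐ⟧ m m′) (⟦map-·ᵐ⟧ m q) ⟩
      ⟦ m ⟧ᵐ * ⟦ m′ ⟧ᵐ + ⟦ m ⟧ᵐ * ⟦ q ⟧ⁿ  ≈⟨ distribˡ _ _ _ ⟨
      ⟦ m ⟧ᵐ * (⟦ m′ ⟧ᵐ + ⟦ q ⟧ⁿ)         ∎

    ⟦⊠⟧ : ∀ p q → ⟦ p ⊠ q ⟧ⁿ ≈ ⟦ p ⟧ⁿ * ⟦ q ⟧ⁿ
    ⟦⊠⟧ []      q = sym (zeroˡ _)
    ⟦⊠⟧ (m ∷ p) q = begin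
      ⟦ map (m ·ᵐ_) q ⊞ p ⊠ q ⟧ⁿ        ≈⟨ ⟦⊞⟧ (map (m ·ᵐ_) q) (p ⊠ q) ⟩
      ⟦ map (m ·ᵐ_) q ⟧ⁿ + ⟦ p ⊠ q ⟧ⁿ   ≈⟨ +-cong (⟦map-·ᵐ⟧ m q) (⟦⊠⟧ p q) ⟩
      ⟦ m ⟧ᵐ * ⟦ q ⟧ⁿ + ⟦ p ⟧ⁿ * ⟦ q ⟧ⁿ ≈⟨ distribʳ _ _ _ ⟨
      (⟦ m ⟧ᵐ + ⟦ p ⟧ⁿ) * ⟦ q ⟧ⁿ        ∎

  ⟦_⇓⟧ : ∀ {n} → Expr n → Vec Carrier n → Carrier
  ⟦ e ⇓⟧ ρ = ⟦_⟧ⁿ ρ (normalise e)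

  normalise-correct : ∀ {n} (e : Expr n) ρ → ⟦ e ⇓⟧ ρ ≈ ⟦ e ⟧ ρ
  normalise-correct (var i) ρ = +-identityʳ _
  normalise-correct (e ⊕ f) ρ =
    trans (⟦⊞⟧ ρ (normalise e) (normalise f)) (+-cong (normalise-correct e ρ) (normalise-correct f ρ))
  normalise-correct (e ⊗ f) ρ =
    trans (⟦⊠⟧ ρ (normalise e) (normalise f)) (*-cong (normalise-correct e ρ) (normalise-correct f ρ))
  normalise-correct (⊝ e) ρ =
    trans (⟦map-negate⟧ ρ (normalise e)) (-‿cong (normalise-correct e ρ))

  open Reflection setoid var ⟦_⟧ ⟦_⇓⟧ normalise-correct public using (solve; _⊜_)

record IsRotaBaxterOperator₁ {r ℓ} (𝓡 : RingWithoutOne r ℓ) (R : RingWithoutOne.Carrier 𝓡 → RingWithoutOne.Carrier 𝓡)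
       : Set (r ⊔ ℓ) where
  open RingWithoutOne 𝓡
  field
    R-cong       : ∀ {a b} → a ≈ b → R a ≈ R b
    R-+-homo     : ∀ a b → R (a + b) ≈ R a + R b
    R-rotaBaxter : ∀ a b → R a * R b ≈ R (R a * b + a * R b) + R (a * b)

module RotaBaxterOperator₁ {r ℓ} {𝓡 : RingWithoutOne r ℓ} {R : RingWithoutOne.Carrier 𝓡 → RingWithoutOne.Carrier 𝓡}
                           (isRotaBaxter : IsRotaBaxterOperator₁ 𝓡 R) where

  open RingWithoutOne 𝓡
  open IsRotaBaxterOperator₁ isRotaBaxter
  open import Algebra.Properties.RingWithoutOne 𝓡
  open import Relation.Binary.Reasoning.Setoid setoid
  open NonUnitalRingSolver 𝓡

  infixl 7 _⋆_ _•_

  _⋆_ : Carrier → Carrier → Carrier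
  a ⋆ b = R a * b + a * R b + a * b

  _•_ : Carrier → Carrier → Carrier
  a • b = R a * b - b * R a - b * a

  ⁅_,_⁆ : Carrier → Carrier → Carrier
  ⁅ u , v ⁆ = u * v - v * u

  R-0#-homo : R 0# ≈ 0#
  R-0#-homo = x+x≈x⇒x≈0 (R 0#) (trans (sym (R-+-homo 0# 0#)) (R-cong (+-identityˡ 0#)))

  R-‿homo : ∀ a → R (- a) ≈ - R a
  R-‿homo a = +-inverseʳ-unique (R a) (R (- a))
    (trans (sym (R-+-homo a (- a))) (trans (R-cong (-‿inverseʳ a)) R-0#-homo))

  R-minus-homo : ∀ a b → R (a - b) ≈ R a - R b
  R-minus-homo a b = trans (R-+-homo a (- b)) (+-congˡ (R-‿homo b))

  R-*-homo : ∀ a b → R a * R b ≈ R (a ⋆ b)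
  R-*-homo a b = trans (R-rotaBaxter a b) (sym (R-+-homo _ _))

  a•b-b•a≈a⋆b-b⋆a : ∀ a b → a • b - b • a ≈ a ⋆ b - b ⋆ a
  a•b-b•a≈a⋆b-b⋆a a b = solve 4
    (λ a b x y → (x ⊗ b ⊖ b ⊗ x ⊖ b ⊗ a) ⊖ (y ⊗ a ⊖ a ⊗ y ⊖ a ⊗ b)
               ⊜ (x ⊗ b ⊕ a ⊗ y ⊕ a ⊗ b) ⊖ (y ⊗ a ⊕ b ⊗ x ⊕ b ⊗ a))
    refl a b (R a) (R b)

  R[a•b]-R[b•a]≈⁅Ra,Rb⁆ : ∀ a b → R (a • b) - R (b • a) ≈ ⁅ R a , R b ⁆
  R[a•b]-R[b•a]≈⁅Ra,Rb⁆ a b = begin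
    R (a • b) - R (b • a)      ≈⟨ R-minus-homo _ _ ⟨
    R (a • b - b • a)          ≈⟨ R-cong (a•b-b•a≈a⋆b-b⋆a a b) ⟩
    R (a ⋆ b - b ⋆ a)          ≈⟨ R-minus-homo _ _ ⟩
    R (a ⋆ b) - R (b ⋆ a)      ≈⟨ +-cong (R-*-homo a b) (-‿cong (R-*-homo b a)) ⟨
    R a * R b - R b * R a      ∎

  •-associator-antisym : ∀ a b c →
    (a • b) • c - a • (b • c) - ((b • a) • c - b • (a • c))
      ≈ ⁅ R (a • b) - R (b • a) - ⁅ R a , R b ⁆ , c ⁆
  •-associator-antisym a b c = solve 7
    (λ a b c x y r s →
      bullet r (bullet x a b) c ⊖ bullet x a (bullet y b c)
        ⊖ (bullet s (bullet y b a) c ⊖ bullet y b (bullet x a c))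
      ⊜ commutator (r ⊖ s ⊖ commutator x y) c)
    refl a b c (R a) (R b) (R (a • b)) (R (b • a))
    where
    commutator : Expr 7 → Expr 7 → Expr 7
    commutator u v = u ⊗ v ⊖ v ⊗ u
    bullet : Expr 7 → Expr 7 → Expr 7 → Expr 7
    bullet Ra a b = Ra ⊗ b ⊖ b ⊗ Ra ⊖ b ⊗ a

  ⁅0,v⁆≈0 : ∀ {u} v → u ≈ 0# → ⁅ u , v ⁆ ≈ 0#
  ⁅0,v⁆≈0 {u} v u≈0 = x≈y⇒x∙y⁻¹≈ε (begin
    u * v    ≈⟨ *-congʳ u≈0 ⟩
    0# * v   ≈⟨ zeroˡ v ⟩
    0#       ≈⟨ zeroʳ v ⟨
    v * 0#   ≈⟨ *-congˡ u≈0 ⟨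
    v * u    ∎)

  •-isLeftPreLie : ∀ a b c → (a • b) • c - a • (b • c) ≈ (b • a) • c - b • (a • c)
  •-isLeftPreLie a b c = x∙y⁻¹≈ε⇒x≈y _ _ (begin
    (a • b) • c - a • (b • c) - ((b • a) • c - b • (a • c))  ≈⟨ •-associator-antisym a b c ⟩
    ⁅ R (a • b) - R (b • a) - ⁅ R a , R b ⁆ , c ⁆            ≈⟨ ⁅0,v⁆≈0 c (x≈y⇒x∙y⁻¹≈ε (R[a•b]-R[b•a]≈⁅Ra,Rb⁆ a b)) ⟩
    0#                                                        ∎)

  Ra⋆b-b⋆Ra-b⋆a≈Ra•b+a•Rb+a•b : ∀ a b →
    R a ⋆ b - b ⋆ R a - b ⋆ a ≈ R a • b + a • R b + a • b
  Ra⋆b-b⋆Ra-b⋆a≈Ra•b+a•Rb+a•b a b = solve 5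
    (λ a b x y X →
      (X ⊗ b ⊕ x ⊗ y ⊕ x ⊗ b) ⊖ (y ⊗ x ⊕ b ⊗ X ⊕ b ⊗ x) ⊖ (y ⊗ a ⊕ b ⊗ x ⊕ b ⊗ a)
      ⊜ (X ⊗ b ⊖ b ⊗ X ⊖ b ⊗ x) ⊕ (x ⊗ y ⊖ y ⊗ x ⊖ y ⊗ a) ⊕ (x ⊗ b ⊖ b ⊗ x ⊖ b ⊗ a))
    refl a b (R a) (R b) (R (R a))

  •-rotaBaxter : ∀ a b → R a • R b ≈ R (R a • b + a • R b) + R (a • b)
  •-rotaBaxter a b = begin
    R (R a) * R b - R b * R (R a) - R b * R a
      ≈⟨ +-cong (+-cong (R-*-homo (R a) b) (-‿cong (R-*-homo b (R a)))) (-‿cong (R-*-homo b a)) ⟩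
    R (R a ⋆ b) - R (b ⋆ R a) - R (b ⋆ a)
      ≈⟨ trans (R-minus-homo _ _) (+-congʳ (R-minus-homo _ _)) ⟨
    R (R a ⋆ b - b ⋆ R a - b ⋆ a)
      ≈⟨ R-cong (Ra⋆b-b⋆Ra-b⋆a≈Ra•b+a•Rb+a•b a b) ⟩
    R (R a • b + a • R b + a • b)
      ≈⟨ R-+-homo _ _ ⟩
    R (R a • b + a • R b) + R (a • b) ∎

assocAlgebra⇒ringWithoutOne : ∀ {c ℓ m ℓm} {K : CommutativeRing c ℓ} →
                              AssocAlgebra K m ℓm → RingWithoutOne m ℓm
assocAlgebra⇒ringWithoutOne A = record
  { isRingWithoutOne = record
    { +-isAbelianGroup = +ᴹ-isAbelianGroup
    ; *-cong           = ·-cong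
    ; *-assoc          = ·-assoc
    ; distrib          = ·-distribˡ , ·-distribʳ
    }
  }
  where open AssocAlgebra A

mainTheorem13 : {c ℓ m ℓm : Level} (K : CommutativeRing c ℓ) → IsField K → CharZero K →
                (A : AssocAlgebra K m ℓm) (R : AssocAlgebra.Carrierᴹ A → AssocAlgebra.Carrierᴹ A) →
                IsRotaBaxter₁ A R →
                IsRotaBaxterPreLie₁ A (bulletR A R) R
mainTheorem13 _ _ _ A R (linear , rotaBaxter) = •-isLeftPreLie , •-rotaBaxter
  where
  isRotaBaxter : IsRotaBaxterOperator₁ (assocAlgebra⇒ringWithoutOne A) R
  isRotaBaxter = record
    { R-cong       = IsLinear.cong linear
    ; R-+-homo     = IsLinear.additive linear
    ; R-rotaBaxter = rotaBaxter
    }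

  open RotaBaxterOperator₁ isRotaBaxter
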